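{- Let $G$ be a thin graph, let $x\in\mathbb{B}(G)$, and let $H\subseteq G$ be an induced subgraph with $N[x]\subseteq V(H)$. Then $|S_H(x)|=1$ and $x\in\mathbb{B}(H)$.
   Context: All graphs are finite, simple, connected, undirected. $N[v]$ is the closed neighborhood of $v$ in $G$, and $\langle W\rangle$ is the induced subgraph on $W$. $G$ is thin if no two distinct vertices have equal closed neighborhoods. For an induced subgraph $H$ of $G$ and $x\in V(H)$, $S_H(x)=\{v\in V(H): N^G[v]\cap V(H)=N^G[x]\cap V(H)\}$. For a graph $K$, its backbone is $\mathbb{B}(K)=\{v\in V(K): |S^K_{\langle N^K[v]\rangle}(v)|=1\}$, where $S^K$ is computed within $K$. -}

module Defs where

open import Data.Nat using (ℕ)
open import Data.Bool using (Bool; true; false; _∧_; _∨_)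
open import Data.Fin using (Fin)
open import Data.Fin.Properties using () renaming (_≟_ to _≟ᶠ_)
open import Data.Fin.Subset public using (Subset; _∈_; _⊆_; _∩_; ⊤; ∣_∣)
open import Data.Vec using (tabulate; lookup)
open import Data.Vec.Properties using (≡-dec)
open import Data.Bool.Properties using () renaming (_≟_ to _≟ᵇ_)
open import Data.Product using (_×_; Σ)
open import Relation.Nullary.Decidable using (isYes)
open import Relation.Binary.PropositionalEquality using (_≡_)

record Graph (n : ℕ) : Set where
  field
    adj     : Fin n → Fin n → Bool
    adj-sym : ∀ u v → adj u v ≡ adj v u
    irrefl  : ∀ v → adj v v ≡ false
open Graph public

-- Vertex subsets W ⊆ V(G) represent induced subgraphs ⟨W⟩; ⊤ represents G itself.

N : ∀ {n} → Graph n → Fin n → Subset n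
N G v = tabulate (λ u → isYes (u ≟ᶠ v) ∨ adj G v u)

NIn : ∀ {n} → Graph n → Subset n → Fin n → Subset n
NIn G K v = N G v ∩ K

-- S^K_H(x) for graph K = ⟨K⟩ and induced subgraph ⟨H⟩ of K:
-- { v ∈ H : N^K[v] ∩ H = N^K[x] ∩ H }
S : ∀ {n} → Graph n → (K H : Subset n) → Fin n → Subset n
S G K H x = tabulate (λ v → lookup H v ∧
  isYes (≡-dec _≟ᵇ_ (NIn G K v ∩ H) (NIn G K x ∩ H)))

InBackbone : ∀ {n} → Graph n → Subset n → Fin n → Set
InBackbone G K v = v ∈ K × ∣ S G K (NIn G K v) v ∣ ≡ 1

Thin : ∀ {n} → Graph n → Set
Thin G = ∀ u v → N G u ≡ N G v → u ≡ v

data Walk {n} (G : Graph n) (W : Subset n) : Fin n → Fin n → Set where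
  here : ∀ {v} → v ∈ W → Walk G W v v
  step : ∀ {u v w} → u ∈ W → adj G u v ≡ true → Walk G W v w → Walk G W u w

Connected : ∀ {n} → Graph n → Subset n → Set
Connected G W = Σ (Fin _) (λ v → v ∈ W) × (∀ u v → u ∈ W → v ∈ W → Walk G W u v)

-- If N[x] ⊆ V(H), a vertex v agreeing with x on H sees x, so v ∈ N[x], and it
-- agrees with x on N[x] in particular. Hence S_H(x), and likewise the set
-- S^H_{⟨N^H[x]⟩}(x) defining the backbone of H, lies in S_{⟨N[x]⟩}(x) = {x} and
-- contains x.
module Submission where

open import Defs
open import Data.Nat using (ℕ)
open import Data.Nat.Properties using (≤-antisym; ≤-trans; ≤-reflexive)
open import Data.Bool using (Bool; true; _∧_; _∨_)
open import Data.Bool.Properties using (∧-conicalˡ; ∧-conicalʳ; ∨-zeroʳ; T-≡) renaming (_≟_ to _≟ᵇ_)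
open import Data.Fin using (Fin)
open import Data.Fin.Properties using () renaming (_≟_ to _≟ᶠ_)
open import Data.Fin.Subset.Properties
  using (∈⊤; ∩-assoc; x∈p∩q⁺; x∈p∩q⁻; ⊆-antisym; p⊆q⇒∣p∣≤∣q∣; ∣⁅x⁆∣≡1; x∈⁅y⁆⇒x≡y)
open import Data.Vec using (lookup; tabulate)
open import Data.Vec.Properties using (≡-dec; []=⇒lookup; lookup⇒[]=; lookup∘tabulate)
open import Data.Product using (_×_; _,_; proj₁; proj₂)
open import Function using (Equivalence)
open import Relation.Nullary using (Dec; yes; no; contradiction)
open import Relation.Nullary.Decidable using (isYes; toWitness; fromWitness)
open import Relation.Binary.PropositionalEquality using (_≡_; refl; sym; trans; cong; cong₂; subst)

open Equivalence using (to; from)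

private
  variable
    n : ℕ

∈tabulate⁺ : {f : Fin n → Bool} {v : Fin n} → f v ≡ true → v ∈ tabulate f
∈tabulate⁺ {f = f} {v} fv = lookup⇒[]= v (tabulate f) (trans (lookup∘tabulate f v) fv)

∈tabulate⁻ : {f : Fin n → Bool} {v : Fin n} → v ∈ tabulate f → f v ≡ true
∈tabulate⁻ {f = f} {v} v∈ = trans (sym (lookup∘tabulate f v)) ([]=⇒lookup v∈)

∣p∣≡1⇐p⊆q∧∣q∣≡1 : {p q : Subset n} {x : Fin n} →
                  x ∈ p → p ⊆ q → ∣ q ∣ ≡ 1 → ∣ p ∣ ≡ 1
∣p∣≡1⇐p⊆q∧∣q∣≡1 {p = p} {x = x} x∈p p⊆q ∣q∣≡1 = ≤-antisym
  (≤-trans (p⊆q⇒∣p∣≤∣q∣ p⊆q) (≤-reflexive ∣q∣≡1))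
  (≤-trans (≤-reflexive (sym (∣⁅x⁆∣≡1 x)))
    (p⊆q⇒∣p∣≤∣q∣ λ y∈⁅x⁆ → subst (_∈ p) (sym (x∈⁅y⁆⇒x≡y x y∈⁅x⁆)) x∈p))

x∈[p∩q]∩r⁺ : {p q r : Subset n} {x : Fin n} → x ∈ p → x ∈ q ∩ r → x ∈ (p ∩ q) ∩ r
x∈[p∩q]∩r⁺ {p = p} {q} {r} x∈p x∈q∩r = subst (_ ∈_) (sym (∩-assoc p q r)) (x∈p∩q⁺ (x∈p , x∈q∩r))

x∈[p∩q]∩r⁻ : {p q r : Subset n} {x : Fin n} → x ∈ (p ∩ q) ∩ r → x ∈ p × x ∈ q ∩ r
x∈[p∩q]∩r⁻ {p = p} {q} {r} x∈ = x∈p∩q⁻ p (q ∩ r) (subst (_ ∈_) (∩-assoc p q r) x∈)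

module _ (G : Graph n) where

  x∈N[x] : (x : Fin n) → x ∈ N G x
  x∈N[x] x = ∈tabulate⁺ x≟x
    where
    x≟x : isYes (x ≟ᶠ x) ∨ adj G x x ≡ true
    x≟x with x ≟ᶠ x
    ... | yes _  = refl
    ... | no x≢x = contradiction refl x≢x

  ∈N-sym : {u v : Fin n} → u ∈ N G v → v ∈ N G u
  ∈N-sym {u} {v} u∈N[v] with u ≟ᶠ v | ∈tabulate⁻ u∈N[v]
  ... | yes refl | _        = x∈N[x] u
  ... | no _     | adj-v-u = ∈tabulate⁺
    (trans (cong (isYes (v ≟ᶠ u) ∨_) (trans (adj-sym G u v) adj-v-u)) (∨-zeroʳ _))

  module _ {K H : Subset n} {x : Fin n} where

    ∈S⁻ : {v : Fin n} → v ∈ S G K H x → v ∈ H × NIn G K v ∩ H ≡ NIn G K x ∩ H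
    ∈S⁻ {v} v∈S = lookup⇒[]= v H (∧-conicalˡ _ _ v∈S-bool)
                , toWitness {a? = agree?} (from T-≡ (∧-conicalʳ _ _ v∈S-bool))
      where
      agree? : Dec (NIn G K v ∩ H ≡ NIn G K x ∩ H)
      agree? = ≡-dec _≟ᵇ_ (NIn G K v ∩ H) (NIn G K x ∩ H)
      v∈S-bool : lookup H v ∧ isYes agree? ≡ true
      v∈S-bool = ∈tabulate⁻ v∈S

    ∈S⁺ : {v : Fin n} → v ∈ H → NIn G K v ∩ H ≡ NIn G K x ∩ H → v ∈ S G K H x
    ∈S⁺ v∈H agree = ∈tabulate⁺ (cong₂ _∧_ ([]=⇒lookup v∈H) (to T-≡ (fromWitness agree)))

    x∈S[x] : x ∈ H → x ∈ S G K H x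
    x∈S[x] x∈H = ∈S⁺ x∈H refl

    ∈S⇒∈N : {v : Fin n} → x ∈ K ∩ H → v ∈ S G K H x → v ∈ N G x
    ∈S⇒∈N x∈K∩H v∈S with ∈S⁻ v∈S
    ... | _ , agree = ∈N-sym (proj₁ (x∈[p∩q]∩r⁻
          (subst (x ∈_) (sym agree) (x∈[p∩q]∩r⁺ (x∈N[x] x) x∈K∩H))))

  agreement-restrict : {K H K′ H′ : Subset n} {a b : Fin n} → K′ ∩ H′ ⊆ K ∩ H →
                       NIn G K a ∩ H ≡ NIn G K b ∩ H → NIn G K′ a ∩ H′ ⊆ NIn G K′ b ∩ H′
  agreement-restrict {b = b} K′∩H′⊆K∩H agree {u} u∈ with x∈[p∩q]∩r⁻ u∈
  ... | u∈N[a] , u∈K′∩H′ = x∈[p∩q]∩r⁺ u∈N[b] u∈K′∩H′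
    where
    u∈N[b] : u ∈ N G b
    u∈N[b] = proj₁ (x∈[p∩q]∩r⁻ (subst (_ ∈_) agree (x∈[p∩q]∩r⁺ u∈N[a] (K′∩H′⊆K∩H u∈K′∩H′))))

  S-restrict : {K H K′ H′ : Subset n} {x v : Fin n} → K′ ∩ H′ ⊆ K ∩ H →
               v ∈ H′ → v ∈ S G K H x → v ∈ S G K′ H′ x
  S-restrict K′∩H′⊆K∩H v∈H′ v∈S with ∈S⁻ v∈S
  ... | _ , agree = ∈S⁺ v∈H′ (⊆-antisym (agreement-restrict K′∩H′⊆K∩H agree)
                                        (agreement-restrict K′∩H′⊆K∩H (sym agree)))

  S⊆S[N[x]] : {K H : Subset n} {x : Fin n} → N G x ⊆ K ∩ H →
              S G K H x ⊆ S G ⊤ (NIn G ⊤ x) x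
  S⊆S[N[x]] {x = x} N[x]⊆K∩H v∈S =
    S-restrict (λ u∈ → N[x]⊆K∩H (proj₁ (x∈p∩q⁻ (N G x) ⊤ (proj₂ (x∈p∩q⁻ ⊤ _ u∈)))))
               (x∈p∩q⁺ (∈S⇒∈N (N[x]⊆K∩H (x∈N[x] x)) v∈S , ∈⊤)) v∈S

lemma3p19 : ∀ {n} (G : Graph n) → Connected G ⊤ → Thin G →
    (x : Fin n) → InBackbone G ⊤ x →
    (H : Subset n) → Connected G H → N G x ⊆ H →
    (∣ S G ⊤ H x ∣ ≡ 1) × InBackbone G H x
lemma3p19 G _ _ x (_ , x-backbone) H _ N[x]⊆H =
  unique (x∈S[x] G x∈H) (S⊆S[N[x]] G λ u∈N[x] → x∈p∩q⁺ (∈⊤ , N[x]⊆H u∈N[x])) ,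
  x∈H ,
  unique (x∈S[x] G (x∈p∩q⁺ (x∈N[x] G x , x∈H)))
         (S⊆S[N[x]] G λ u∈N[x] → x∈p∩q⁺ (N[x]⊆H u∈N[x] , x∈p∩q⁺ (u∈N[x] , N[x]⊆H u∈N[x])))
  where
  x∈H : x ∈ H
  x∈H = N[x]⊆H (x∈N[x] G x)
  unique : {A : Subset _} → x ∈ A → A ⊆ S G ⊤ (NIn G ⊤ x) x → ∣ A ∣ ≡ 1
  unique x∈A A⊆S = ∣p∣≡1⇐p⊆q∧∣q∣≡1 x∈A A⊆S x-backbone
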